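{- For the weighted paging problem, the greedy algorithm that on each fault evicts a page of smallest eviction cost from the cache is bijectively optimal: for every $n$ and every online algorithm $B$ there is a bijection $\pi:\mathcal{I}_n\to\mathcal{I}_n$ with $\textsc{greedy}(\sigma)\le B(\pi(\sigma))$ for all $\sigma\in\mathcal{I}_n$.
   Context: Weighted paging: there is a finite set of pages, each page $p$ having an eviction cost $c_p>0$, and a cache holding $k$ pages (initially a given set of $k$ pages, the same for all algorithms). Requests are pages; if the requested page is not in the cache (a fault), the algorithm must bring it into the cache, evicting some page $q$ currently in the cache at cost $c_q$. The cost $A(\sigma)$ of an algorithm on $\sigma$ is the total eviction cost. $\mathcal{I}_n$ is the set of all request sequences of length $n$. (Equivalently: $k$-server on a star whose leaves are the pages, the edge to leaf $p$ having weight $c_p/2$, with requests only at leaves.)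
   Formalization: The eviction costs $c_p$ are taken to be positive rationals. -}

module Defs where

open import Data.Nat using (ℕ)
open import Data.Fin using (Fin; _≟_)
open import Data.List using (List; []; _∷_)
open import Data.Vec using (Vec; lookup; _[_]≔_)
open import Data.Rational using (ℚ; 0ℚ; _+_; _≤_)
open import Relation.Nullary using (yes; no; Dec)
open import Data.Vec.Relation.Unary.Any using (Any; any?)
open import Relation.Binary.PropositionalEquality using (_≡_)

Page : ℕ → Set
Page m = Fin m

Cache : ℕ → ℕ → Set
Cache m k = Vec (Page m) k

Distinct : ∀ {m k} → Cache m k → Set
Distinct {m} {k} C = (i j : Fin k) → lookup C i ≡ lookup C j → i ≡ j

-- A deterministic online paging algorithm: on a fault it chooses the slot
-- whose page is evicted, as a function of the history of past requests
-- (most recent first), the current cache content and the current request.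
Alg : ℕ → ℕ → Set
Alg m k = List (Page m) → Cache m k → Page m → Fin k

_∈?_ : ∀ {m k} (p : Page m) (C : Cache m k) → Dec (Any (p ≡_) C)
p ∈? C = any? (p ≟_) C

run : ∀ {m k} → (Page m → ℚ) → Alg m k → List (Page m) → Cache m k → List (Page m) → ℚ
run c A h C [] = 0ℚ
run c A h C (r ∷ rs) with r ∈? C
... | yes _ = run c A (r ∷ h) C rs
... | no _  = c (lookup C (A h C r)) + run c A (r ∷ h) (C [ A h C r ]≔ r) rs

costOf : ∀ {m k} → (Page m → ℚ) → Alg m k → Cache m k → List (Page m) → ℚ
costOf c A C₀ σ = run c A [] C₀ σ

-- Greedy: on each fault it evicts a page of smallest eviction cost in the
-- cache (ties broken arbitrarily, i.e. any such rule counts as greedy).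
IsGreedy : ∀ {m k} → (Page m → ℚ) → Alg m k → Set
IsGreedy {m} {k} c G =
  (h : List (Page m)) (C : Cache m k) (r : Page m) (i : Fin k) →
  c (lookup C (G h C r)) ≤ c (lookup C i)

-- Greedy is compared with an arbitrary online algorithm B at the first fault on which
-- B evicts some page q instead of greedy's cheapest page x.  From there on it suffices
-- to show that greedy started in the cache without x is bijectively no worse than
-- greedy started in the cache without q, given the head start c q - c x.  This
-- comparison is an induction along a coupling of the two greedy runs: a permutation ρ
-- of the pages maps the first cache onto the second and preserves costs, except that
-- one page a of the first cache and one page o outside it exchange their costs, and
-- the costs A, B paid so far satisfy A ≤ B and A + c a ≤ B + c o.  A request r in the
-- first run is answered by the request ρ r in the second, so both runs fault together;
-- since both evict pages of minimal cost, composing ρ with at most two transpositions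
-- restores the coupling.  Reading the relabellings request by request gives the
-- bijection on request sequences.
{-# OPTIONS --safe #-}
module Submission where

open import Defs
open import Algebra.Bundles using (CommutativeMonoid)
import Algebra.Properties.CommutativeSemigroup as CommutativeSemigroupProperties
open import Data.Empty using (⊥-elim)
open import Data.Fin using (Fin; _≟_)
open import Data.Fin.Permutation using (Permutation′; _⟨$⟩ʳ_; _⟨$⟩ˡ_; _∘ₚ_; inverseʳ)
import Data.Fin.Permutation as Perm
open import Data.Fin.Permutation.Components using (transpose; transpose-inverse)
open import Data.List using (_∷_)
open import Data.Nat using (ℕ; zero; suc)
open import Data.Product using (Σ; _×_; _,_; uncurry)
open import Data.Product.Function.NonDependent.Propositional using (_×-⇔_)
open import Data.Rational using (ℚ; 0ℚ; _<_; _≤_; _+_)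
open import Data.Rational.Properties
  using (≤-refl; ≤-trans; ≤-reflexive; ≤-antisym; +-mono-≤; +-monoˡ-≤; +-monoʳ-≤;
         +-identityˡ; +-assoc; +-0-commutativeMonoid; module ≤-Reasoning)
open import Data.Sum using (_⊎_; inj₁; inj₂; [_,_])
open import Data.Sum.Function.Propositional using (_⊎-⇔_)
open import Data.Vec using (Vec; []; _∷_; lookup; _[_]≔_; toList)
open import Data.Vec.Properties using (lookup∘update; lookup∘update′)
open import Data.Vec.Membership.Propositional using (_∈_; _∉_)
open import Data.Vec.Membership.Propositional.Properties using (∈-lookup)
open import Data.Vec.Relation.Unary.Any using (index)
open import Data.Vec.Relation.Unary.Any.Properties using (lookup-index)
open import Function.Base using (_∘_; id)
open import Function.Bundles using (_⇔_; mk⇔; Equivalence; _↔_; mk↔ₛ′; Inverse; Injection; _⤖_; Bijection)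
open import Function.Construct.Composition using (_⇔-∘_; _↔-∘_)
open import Function.Construct.Identity using (↔-id)
open import Function.Definitions using (Injective)
open import Function.Properties.Equivalence using () renaming (refl to ⇔-refl; sym to ⇔-sym)
open import Function.Properties.Inverse using (↔⇒↣; ↔⇒⤖)
open import Function.Related.TypeIsomorphisms using (¬-cong-⇔)
open import Relation.Nullary using (Dec; yes; no)
open import Relation.Nullary.Negation using (contradiction)
open import Relation.Binary.PropositionalEquality hiding ([_])

open CommutativeSemigroupProperties (CommutativeMonoid.commutativeSemigroup +-0-commutativeMonoid)
  using (xy∙z≈xz∙y)

module _ {n : ℕ} where

  transpose-atˡ : ∀ (i j : Fin n) → transpose i j i ≡ j
  transpose-atˡ i j with i ≟ i
  ... | yes _   = refl
  ... | no i≢i = contradiction refl i≢i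

  transpose-atʳ : ∀ (i j : Fin n) → transpose i j j ≡ i
  transpose-atʳ i j with j ≟ i
  ... | yes j≡i = j≡i
  ... | no _ with j ≟ j
  ...   | yes _   = refl
  ...   | no j≢j = contradiction refl j≢j

  transpose-fixed : ∀ {i j k : Fin n} → k ≢ i → k ≢ j → transpose i j k ≡ k
  transpose-fixed {i} {j} {k} k≢i k≢j with k ≟ i
  ... | yes k≡i = contradiction k≡i k≢i
  ... | no _ with k ≟ j
  ...   | yes k≡j = contradiction k≡j k≢j
  ...   | no _    = refl

  data Position (i j : Fin n) : Fin n → Set where
    at-i      : Position i j i
    at-j      : Position i j j
    elsewhere : ∀ {k} → k ≢ i → k ≢ j → Position i j k

  position : ∀ i j k → Position i j k
  position i j k with k ≟ i | k ≟ j
  ... | yes refl | _        = at-i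
  ... | no _     | yes refl = at-j
  ... | no k≢i   | no k≢j   = elsewhere k≢i k≢j

  transpose-comm : ∀ (i j k : Fin n) → transpose i j k ≡ transpose j i k
  transpose-comm i j k with position i j k
  ... | at-i              = trans (transpose-atˡ i j) (sym (transpose-atʳ j i))
  ... | at-j              = trans (transpose-atʳ i j) (sym (transpose-atˡ j i))
  ... | elsewhere k≢i k≢j = trans (transpose-fixed k≢i k≢j) (sym (transpose-fixed k≢j k≢i))

  transpose-involutive : ∀ (i j k : Fin n) → transpose i j (transpose i j k) ≡ k
  transpose-involutive i j k = trans (cong (transpose i j) (transpose-comm i j k)) (transpose-inverse i j)

  transpose-injective : ∀ (i j : Fin n) → Injective _≡_ _≡_ (transpose i j)
  transpose-injective i j {k} {l} eq =
    trans (sym (transpose-involutive i j k)) (trans (cong (transpose i j) eq) (transpose-involutive i j l))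

  transpose-refl : ∀ (i k : Fin n) → transpose i i k ≡ k
  transpose-refl i k with position i i k
  ... | at-i            = transpose-atˡ i i
  ... | at-j            = transpose-atˡ i i
  ... | elsewhere k≢i _ = transpose-fixed k≢i k≢i

  transpose-natural : ∀ {f : Fin n → Fin n} → Injective _≡_ _≡_ f →
                      ∀ i j k → f (transpose i j k) ≡ transpose (f i) (f j) (f k)
  transpose-natural {f} f-injective i j k with position i j k
  ... | at-i = trans (cong f (transpose-atˡ i j)) (sym (transpose-atˡ (f i) (f j)))
  ... | at-j = trans (cong f (transpose-atʳ i j)) (sym (transpose-atʳ (f i) (f j)))
  ... | elsewhere k≢i k≢j =
    trans (cong f (transpose-fixed k≢i k≢j)) (sym (transpose-fixed (k≢i ∘ f-injective) (k≢j ∘ f-injective)))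

  transpose-conj : ∀ (i j k l p : Fin n) →
                   transpose i j (transpose k l (transpose i j p)) ≡ transpose (transpose i j k) (transpose i j l) p
  transpose-conj i j k l p =
    trans (transpose-natural (transpose-injective i j) k l (transpose i j p))
          (cong (transpose (transpose i j k) (transpose i j l)) (transpose-involutive i j p))

  transpose-invariant : ∀ {b} {B : Set b} (f : Fin n → B) {i j} → f i ≡ f j →
                        ∀ k → f (transpose i j k) ≡ f k
  transpose-invariant f {i} {j} fi≡fj k with position i j k
  ... | at-i              = trans (cong f (transpose-atˡ i j)) (sym fi≡fj)
  ... | at-j              = trans (cong f (transpose-atʳ i j)) fi≡fj
  ... | elsewhere k≢i k≢j = cong f (transpose-fixed k≢i k≢j)

  transpose-preserves : ∀ {ℓ} (P : Fin n → Set ℓ) {i j} → P i ⇔ P j →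
                        ∀ k → P k ⇔ P (transpose i j k)
  transpose-preserves P {i} {j} Pi⇔Pj k with position i j k
  ... | at-i              = subst (λ l → P i ⇔ P l) (sym (transpose-atˡ i j)) Pi⇔Pj
  ... | at-j              = subst (λ l → P j ⇔ P l) (sym (transpose-atʳ i j)) (⇔-sym Pi⇔Pj)
  ... | elsewhere k≢i k≢j = subst (λ l → P k ⇔ P l) (sym (transpose-fixed k≢i k≢j)) ⇔-refl

module _ {a} {A : Set a} {n : ℕ} where

  ∈-[]≔-new : ∀ (xs : Vec A n) i x → x ∈ xs [ i ]≔ x
  ∈-[]≔-new xs i x = subst (_∈ xs [ i ]≔ x) (lookup∘update i xs x) (∈-lookup i (xs [ i ]≔ x))

  ∈-[]≔-old : ∀ {xs : Vec A n} {i y} x → x ∈ xs → x ≢ lookup xs i → x ∈ xs [ i ]≔ y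
  ∈-[]≔-old {xs} {i} {y} x x∈xs x≢xsᵢ with index x∈xs ≟ i | lookup-index x∈xs
  ... | yes refl | x≡xsᵢ = contradiction x≡xsᵢ x≢xsᵢ
  ... | no l≢i   | x≡xsₗ =
    subst (_∈ xs [ i ]≔ y) (trans (lookup∘update′ l≢i xs y) (sym x≡xsₗ)) (∈-lookup (index x∈xs) (xs [ i ]≔ y))

module _ {m k : ℕ} where

  ∈∉⇒≢ : ∀ {p q} {X : Cache m k} → p ∈ X → q ∉ X → p ≢ q
  ∈∉⇒≢ p∈X q∉X refl = q∉X p∈X

  ∉⇒≢lookup : ∀ {X : Cache m k} {r} → r ∉ X → ∀ l → r ≢ lookup X l
  ∉⇒≢lookup {X} r∉X l r≡Xₗ = r∉X (subst (_∈ X) (sym r≡Xₗ) (∈-lookup l X))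

  ∈-[]≔⁻ : ∀ {X : Cache m k} {i r p} → Distinct X → p ∈ X [ i ]≔ r → p ≡ r ⊎ (p ∈ X × p ≢ lookup X i)
  ∈-[]≔⁻ {X} {i} {r} X-distinct p∈X′ with index p∈X′ ≟ i | lookup-index p∈X′
  ... | yes l≡i | p≡X′ₗ = inj₁ (trans p≡X′ₗ (trans (cong (lookup (X [ i ]≔ r)) l≡i) (lookup∘update i X r)))
  ... | no l≢i  | p≡X′ₗ =
    inj₂ (subst (_∈ X) (sym p≡Xₗ) (∈-lookup _ X) , l≢i ∘ X-distinct _ i ∘ trans (sym p≡Xₗ))
    where p≡Xₗ = trans p≡X′ₗ (lookup∘update′ l≢i X r)

  ∈-[]≔ : ∀ {X : Cache m k} {i r p} → Distinct X → p ∈ X [ i ]≔ r ⇔ (p ≡ r ⊎ (p ∈ X × p ≢ lookup X i))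
  ∈-[]≔ {X} {i} {r} X-distinct =
    mk⇔ (∈-[]≔⁻ X-distinct) [ (λ { refl → ∈-[]≔-new X i r }) , uncurry (∈-[]≔-old _) ]

  []≔-distinct : ∀ {X : Cache m k} {i r} → Distinct X → r ∉ X → Distinct (X [ i ]≔ r)
  []≔-distinct {X} {i} {r} X-distinct r∉X l l′ eq with l ≟ i | l′ ≟ i
  ... | yes refl | yes refl = refl
  ... | yes refl | no l′≢i  =
    contradiction (trans (sym (lookup∘update l X r)) (trans eq (lookup∘update′ l′≢i X r))) (∉⇒≢lookup r∉X l′)
  ... | no l≢i   | yes refl =
    contradiction (trans (sym (lookup∘update l′ X r)) (trans (sym eq) (lookup∘update′ l≢i X r))) (∉⇒≢lookup r∉X l)
  ... | no l≢i   | no l′≢i  =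
    X-distinct l l′ (trans (sym (lookup∘update′ l≢i X r)) (trans eq (lookup∘update′ l′≢i X r)))

Relabels : ∀ {m k} → Permutation′ m → Cache m k → Cache m k → Set
Relabels ρ X Y = ∀ p → p ∈ X ⇔ ρ ⟨$⟩ʳ p ∈ Y

⟨$⟩ʳ-≡⇔ : ∀ {m} (ρ : Permutation′ m) {p q} → p ≡ q ⇔ ρ ⟨$⟩ʳ p ≡ ρ ⟨$⟩ʳ q
⟨$⟩ʳ-≡⇔ ρ = mk⇔ (cong (ρ ⟨$⟩ʳ_)) (Injection.injective (↔⇒↣ ρ))

module _ {m k : ℕ} {X Y : Cache m k} where

  relabel-transpose : ∀ ρ → Relabels ρ X Y → ∀ {u v} → u ∈ X ⇔ v ∈ X → Relabels (Perm.transpose u v ∘ₚ ρ) X Y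
  relabel-transpose ρ ρ-relabels {u} {v} u⇔v p =
    ρ-relabels (transpose u v p) ⇔-∘ transpose-preserves (λ q → q ∈ X) u⇔v p

  relabel-[]≔ : ∀ ρ → Distinct X → Distinct Y → Relabels ρ X Y →
                ∀ {i j r} → ρ ⟨$⟩ʳ lookup X i ≡ lookup Y j → r ∉ X →
                Relabels ρ (X [ i ]≔ r) (Y [ j ]≔ (ρ ⟨$⟩ʳ r))
  relabel-[]≔ ρ X-distinct Y-distinct ρ-relabels {i} {j} {r} ρXᵢ≡Yⱼ r∉X p =
    ⇔-sym (∈-[]≔ Y-distinct) ⇔-∘ ((⟨$⟩ʳ-≡⇔ ρ ⊎-⇔ (ρ-relabels p ×-⇔ ¬-cong-⇔ p≡Xᵢ⇔ρp≡Yⱼ)) ⇔-∘ ∈-[]≔ X-distinct)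
    where
    p≡Xᵢ⇔ρp≡Yⱼ : p ≡ lookup X i ⇔ ρ ⟨$⟩ʳ p ≡ lookup Y j
    p≡Xᵢ⇔ρp≡Yⱼ = subst (λ y → p ≡ lookup X i ⇔ ρ ⟨$⟩ʳ p ≡ y) ρXᵢ≡Yⱼ (⟨$⟩ʳ-≡⇔ ρ)

-- Bijective domination

module _ {a} {A : Set a} where

  infix 4 _≼_
  record _≼_ {n} (f g : Vec A n → ℚ) : Set a where
    constructor _,_
    field
      bijection : Vec A n ↔ Vec A n
      dominated : ∀ σ → f σ ≤ g (Inverse.to bijection σ)

  ≼-[] : ∀ {f g : Vec A 0 → ℚ} → f [] ≤ g [] → f ≼ g
  ≼-[] f[]≤g[] = ↔-id _ , λ { [] → f[]≤g[] }

  ≼-trans : ∀ {n} {f g h : Vec A n → ℚ} → f ≼ g → g ≼ h → f ≼ h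
  ≼-trans (π , f≤g∘π) (π′ , g≤h∘π′) = π′ ↔-∘ π , λ σ → ≤-trans (f≤g∘π σ) (g≤h∘π′ (Inverse.to π σ))

  ≼-mono : ∀ {n} {f f′ g g′ : Vec A n → ℚ} → (∀ σ → f′ σ ≤ f σ) → (∀ σ → g σ ≤ g′ σ) → f ≼ g → f′ ≼ g′
  ≼-mono f′≤f g≤g′ (π , f≤g∘π) = π , λ σ → ≤-trans (f′≤f σ) (≤-trans (f≤g∘π σ) (g≤g′ _))

  ≼-∷ : ∀ {n} {f g : Vec A (suc n) → ℚ} (ρ : A ↔ A) →
        (∀ r → (λ σ → f (r ∷ σ)) ≼ (λ σ → g (Inverse.to ρ r ∷ σ))) → f ≼ g
  ≼-∷ {n} ρ tails = mk↔ₛ′ to from to∘from from∘to , λ { (r ∷ σ) → _≼_.dominated (tails r) σ }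
    where
    open Inverse ρ using () renaming (to to ρ→; from to ρ←; strictlyInverseˡ to ρ→∘ρ←; strictlyInverseʳ to ρ←∘ρ→)
    π : A → Vec A n ↔ Vec A n
    π r = _≼_.bijection (tails r)
    to from : Vec A (suc n) → Vec A (suc n)
    to   (r ∷ σ) = ρ→ r ∷ Inverse.to (π r) σ
    from (r ∷ σ) = ρ← r ∷ Inverse.from (π (ρ← r)) σ
    to∘from : ∀ σ → to (from σ) ≡ σ
    to∘from (r ∷ σ) = cong₂ _∷_ (ρ→∘ρ← r) (Inverse.strictlyInverseˡ (π (ρ← r)) σ)
    from∘to : ∀ σ → from (to σ) ≡ σ
    from∘to (r ∷ σ) rewrite ρ←∘ρ→ r = cong (r ∷_) (Inverse.strictlyInverseʳ (π r) σ)

-- Couplings of two greedy runs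

module _ {m k : ℕ} (c : Page m → ℚ) where

  -- The case a ≡ o is a coupling without cost defect.
  record Coupling (X Y : Cache m k) (A B : ℚ) : Set where
    field
      ρ            : Permutation′ m
      relabels     : Relabels ρ X Y
      a o          : Page m
      cost         : ∀ p → c (ρ ⟨$⟩ʳ p) ≡ c (transpose a o p)
      defect       : a ≡ o ⊎ (a ∈ X × o ∉ X)
      slack        : A ≤ B
      defect-bound : A + c a ≤ B + c o
      X-distinct   : Distinct X
      Y-distinct   : Distinct Y

  module Eviction {X Y : Cache m k} {A B : ℚ}
                  (ρ : Permutation′ m) (ρ-relabels : Relabels ρ X Y)
                  (X-distinct : Distinct X) (Y-distinct : Distinct Y)
                  {r : Page m} (r∉X : r ∉ X) (i j : Fin k)
                  (x-min : ∀ l → c (lookup X i) ≤ c (lookup X l)) where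

    x y z : Page m
    x = lookup X i
    y = lookup Y j
    z = ρ ⟨$⟩ˡ y

    X′ Y′ : Cache m k
    X′ = X [ i ]≔ r
    Y′ = Y [ j ]≔ (ρ ⟨$⟩ʳ r)

    x∈X : x ∈ X
    x∈X = ∈-lookup i X

    ρz≡y : ρ ⟨$⟩ʳ z ≡ y
    ρz≡y = inverseʳ ρ

    z∈X : z ∈ X
    z∈X = Equivalence.from (ρ-relabels z) (subst (_∈ Y) (sym ρz≡y) (∈-lookup j Y))

    stays : ∀ {p} → p ∈ X → p ≢ x → p ∈ X′
    stays {p} = ∈-[]≔-old p

    evicted : x ∉ X′
    evicted x∈X′ with ∈-[]≔⁻ X-distinct x∈X′
    ... | inj₁ x≡r       = r∉X (subst (_∈ X) x≡r x∈X)
    ... | inj₂ (_ , x≢x) = x≢x refl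

    x-min∈ : ∀ {p} → p ∈ X → c x ≤ c p
    x-min∈ p∈X = subst (λ q → c x ≤ c q) (sym (lookup-index p∈X)) (x-min (index p∈X))

    ρ₁ : Permutation′ m
    ρ₁ = Perm.transpose x z ∘ₚ ρ

    ρ₁-relabels : Relabels ρ₁ X′ Y′
    ρ₁-relabels = subst (λ s → Relabels ρ₁ X′ (Y [ j ]≔ (ρ ⟨$⟩ʳ s)))
      (transpose-fixed (∈∉⇒≢ x∈X r∉X ∘ sym) (∈∉⇒≢ z∈X r∉X ∘ sym))
      (relabel-[]≔ ρ₁ X-distinct Y-distinct (relabel-transpose ρ ρ-relabels (mk⇔ (λ _ → z∈X) (λ _ → x∈X)))
        (trans (cong (ρ ⟨$⟩ʳ_) (transpose-atˡ x z)) ρz≡y) r∉X)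

    coupled : (τ : Permutation′ m) → Relabels τ X′ Y′ →
              ∀ a o → (∀ p → c (τ ⟨$⟩ʳ p) ≡ c (transpose a o p)) → a ≡ o ⊎ (a ∈ X′ × o ∉ X′) →
              A + c x ≤ B + c y → (A + c x) + c a ≤ (B + c y) + c o →
              Coupling X′ Y′ (A + c x) (B + c y)
    coupled τ τ-relabels a o cost defect slack bound = record
      { ρ = τ ; relabels = τ-relabels ; a = a ; o = o ; cost = cost ; defect = defect
      ; slack = slack ; defect-bound = bound
      ; X-distinct = []≔-distinct X-distinct r∉X
      ; Y-distinct = []≔-distinct Y-distinct (r∉X ∘ Equivalence.from (ρ-relabels r)) }

    coupled-exactly : (τ : Permutation′ m) → Relabels τ X′ Y′ → (∀ p → c (τ ⟨$⟩ʳ p) ≡ c p) →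
                      A + c x ≤ B + c y → Coupling X′ Y′ (A + c x) (B + c y)
    coupled-exactly τ τ-relabels cost slack =
      coupled τ τ-relabels x x (λ p → trans (cost p) (cong c (sym (transpose-refl x p)))) (inj₁ refl)
        slack (+-monoˡ-≤ (c x) slack)

    bound-evicted : ∀ a → A + c a ≤ B + c y → (A + c x) + c a ≤ (B + c y) + c x
    bound-evicted a A+ca≤B+cy = begin
      (A + c x) + c a ≡⟨ xy∙z≈xz∙y A (c x) (c a) ⟩
      (A + c a) + c x ≤⟨ +-monoˡ-≤ (c x) A+ca≤B+cy ⟩
      (B + c y) + c x ∎
      where open ≤-Reasoning

    evict-exact : (∀ p → c (ρ ⟨$⟩ʳ p) ≡ c p) → A ≤ B → Coupling X′ Y′ (A + c x) (B + c y)
    evict-exact exact A≤B = coupled ρ₁ ρ₁-relabels z x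
      (λ p → trans (exact _) (cong c (transpose-comm x z p))) defect₁
      (+-mono-≤ A≤B (≤-trans (x-min∈ z∈X) (≤-reflexive cz≡cy)))
      (bound-evicted z (+-mono-≤ A≤B (≤-reflexive cz≡cy)))
      where
      cz≡cy : c z ≡ c y
      cz≡cy = trans (sym (exact z)) (cong c ρz≡y)
      defect₁ : z ≡ x ⊎ (z ∈ X′ × x ∉ X′)
      defect₁ with z ≟ x
      ... | yes z≡x = inj₁ z≡x
      ... | no z≢x  = inj₂ (stays z∈X z≢x , evicted)

    module Defect {a o : Page m} (o∉X : o ∉ X) (cost : ∀ p → c (ρ ⟨$⟩ʳ p) ≡ c (transpose a o p)) where

      cost-off : ∀ {p} → p ∈ X → p ≢ a → c (ρ ⟨$⟩ʳ p) ≡ c p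
      cost-off p∈X p≢a = trans (cost _) (cong c (transpose-fixed p≢a (∈∉⇒≢ p∈X o∉X)))

      cost-at : c (ρ ⟨$⟩ʳ a) ≡ c o
      cost-at = trans (cost a) (cong c (transpose-atˡ a o))

      defect-slack : A ≤ B → A + c a ≤ B + c o → A + c x ≤ B + c y
      defect-slack A≤B bound =
        ≤-trans (+-monoʳ-≤ A (x-min∈ z∈X)) (subst (λ q → A + c z ≤ B + c q) ρz≡y moved)
        where
        moved : A + c z ≤ B + c (ρ ⟨$⟩ʳ z)
        moved with z ≟ a
        ... | yes z≡a = subst (λ q → A + c q ≤ B + c (ρ ⟨$⟩ʳ q)) (sym z≡a)
                          (subst (λ q → A + c a ≤ B + q) (sym cost-at) bound)
        ... | no z≢a  = +-mono-≤ A≤B (≤-reflexive (sym (cost-off z∈X z≢a)))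

    -- Where needed below, ρ₁ is composed with the transposition of two pages that are
    -- both in X′ or both outside it; this preserves Relabels and brings the cost defect
    -- back to a single transposition (a′ o′) with a′ ∈ X′ and o′ ∉ X′.

    evict-defect-neither : ∀ {a o} → a ∈ X → o ∉ X → (∀ p → c (ρ ⟨$⟩ʳ p) ≡ c (transpose a o p)) →
                           A ≤ B → A + c a ≤ B + c o → (∀ l → c y ≤ c (lookup Y l)) →
                           x ≢ a → z ≢ a → Coupling X′ Y′ (A + c x) (B + c y)
    evict-defect-neither {a} {o} a∈X o∉X cost A≤B bound y-min x≢a z≢a = by-cases (o ∈? X′)
      where
      open Defect o∉X cost
      cz≡cy : c z ≡ c y
      cz≡cy = trans (sym (cost-off z∈X z≢a)) (cong c ρz≡y)
      cy≤cx : c y ≤ c x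
      cy≤cx = ≤-trans (subst (λ q → c y ≤ c q) (sym (lookup-index ρx∈Y)) (y-min (index ρx∈Y)))
                      (≤-reflexive (cost-off x∈X x≢a))
        where ρx∈Y = Equivalence.to (ρ-relabels x) x∈X
      cx≡cz : c x ≡ c z
      cx≡cz = ≤-antisym (x-min∈ z∈X) (≤-trans (≤-reflexive cz≡cy) cy≤cx)
      cost₁ : ∀ p → c (ρ₁ ⟨$⟩ʳ p) ≡ c (transpose a o p)
      cost₁ p = begin
        c (ρ ⟨$⟩ʳ transpose x z p)                                          ≡⟨ cost _ ⟩
        c (transpose a o (transpose x z p))
          ≡⟨ cong c (transpose-natural (transpose-injective a o) x z p) ⟩
        c (transpose (transpose a o x) (transpose a o z) (transpose a o p))
          ≡⟨ cong₂ (λ u v → c (transpose u v (transpose a o p)))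
                   (transpose-fixed x≢a (∈∉⇒≢ x∈X o∉X)) (transpose-fixed z≢a (∈∉⇒≢ z∈X o∉X)) ⟩
        c (transpose x z (transpose a o p))                                  ≡⟨ transpose-invariant c cx≡cz _ ⟩
        c (transpose a o p)                                                  ∎
        where open ≡-Reasoning
      slack = defect-slack A≤B bound
      a∈X′ = stays a∈X (x≢a ∘ sym)
      by-cases : Dec (o ∈ X′) → Coupling X′ Y′ (A + c x) (B + c y)
      by-cases (no o∉X′) = coupled ρ₁ ρ₁-relabels a o cost₁ (inj₂ (a∈X′ , o∉X′)) slack (begin
        (A + c x) + c a ≡⟨ xy∙z≈xz∙y A (c x) (c a) ⟩
        (A + c a) + c x ≤⟨ +-mono-≤ bound (≤-reflexive (trans cx≡cz cz≡cy)) ⟩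
        (B + c o) + c y ≡⟨ xy∙z≈xz∙y B (c o) (c y) ⟩
        (B + c y) + c o ∎)
        where open ≤-Reasoning
      by-cases (yes o∈X′) = coupled-exactly (Perm.transpose a o ∘ₚ ρ₁)
        (relabel-transpose ρ₁ ρ₁-relabels (mk⇔ (λ _ → o∈X′) (λ _ → a∈X′)))
        (λ p → trans (cost₁ (transpose a o p)) (cong c (transpose-involutive a o p))) slack

    evict-defect-both : ∀ {o} → o ∉ X → (∀ p → c (ρ ⟨$⟩ʳ p) ≡ c (transpose x o p)) →
                        A ≤ B → A + c x ≤ B + c o → z ≡ x → Coupling X′ Y′ (A + c x) (B + c y)
    evict-defect-both {o} o∉X cost A≤B bound z≡x = by-cases (o ∈? X′)
      where
      open Defect o∉X cost
      cy≡co : c y ≡ c o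
      cy≡co = trans (cong c (sym ρz≡y)) (trans (cong (λ q → c (ρ ⟨$⟩ʳ q)) z≡x) cost-at)
      cost₁ : ∀ p → c (ρ₁ ⟨$⟩ʳ p) ≡ c (transpose x o p)
      cost₁ p = trans (cong (λ q → c (ρ ⟨$⟩ʳ q)) (trans (cong (λ w → transpose x w p) z≡x) (transpose-refl x p)))
                      (cost p)
      slack = defect-slack A≤B bound
      by-cases : Dec (o ∈ X′) → Coupling X′ Y′ (A + c x) (B + c y)
      by-cases (no o∉X′) = coupled-exactly (Perm.transpose x o ∘ₚ ρ₁)
        (relabel-transpose ρ₁ ρ₁-relabels (mk⇔ (⊥-elim ∘ evicted) (⊥-elim ∘ o∉X′)))
        (λ p → trans (cost₁ (transpose x o p)) (cong c (transpose-involutive x o p))) slack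
      by-cases (yes o∈X′) = coupled ρ₁ ρ₁-relabels o x (λ p → trans (cost₁ p) (cong c (transpose-comm x o p)))
        (inj₂ (o∈X′ , evicted)) slack (bound-evicted o (+-mono-≤ A≤B (≤-reflexive (sym cy≡co))))

    evict-defect-x : ∀ {o} → o ∉ X → (∀ p → c (ρ ⟨$⟩ʳ p) ≡ c (transpose x o p)) →
                     A ≤ B → A + c x ≤ B + c o → z ≢ x → Coupling X′ Y′ (A + c x) (B + c y)
    evict-defect-x {o} o∉X cost A≤B bound z≢x = by-cases (o ∈? X′)
      where
      open Defect o∉X cost
      z≢o = ∈∉⇒≢ z∈X o∉X
      cz≡cy : c z ≡ c y
      cz≡cy = trans (sym (cost-off z∈X z≢x)) (cong c ρz≡y)
      slack = defect-slack A≤B bound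
      z∈X′ = stays z∈X z≢x

      cost-o-out : ∀ p → c (ρ ⟨$⟩ʳ transpose x z (transpose x o p)) ≡ c (transpose z o p)
      cost-o-out p = begin
        c (ρ ⟨$⟩ʳ transpose x z (transpose x o p))              ≡⟨ cost _ ⟩
        c (transpose x o (transpose x z (transpose x o p)))      ≡⟨ cong c (transpose-conj x o x z p) ⟩
        c (transpose (transpose x o x) (transpose x o z) p)
          ≡⟨ cong₂ (λ u v → c (transpose u v p)) (transpose-atˡ x o) (transpose-fixed z≢x z≢o) ⟩
        c (transpose o z p)                                      ≡⟨ cong c (transpose-comm o z p) ⟩
        c (transpose z o p)                                      ∎
        where open ≡-Reasoning

      cost-o-in : ∀ p → c (ρ ⟨$⟩ʳ transpose x z (transpose z o p)) ≡ c (transpose z x p)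
      cost-o-in p = begin
        c (ρ ⟨$⟩ʳ transpose x z (transpose z o p))              ≡⟨ cost _ ⟩
        c (transpose x o (transpose x z (transpose z o p)))
          ≡⟨ cong (λ q → c (transpose x o q)) (transpose-natural (transpose-injective x z) z o p) ⟩
        c (transpose x o (transpose (transpose x z z) (transpose x z o) (transpose x z p)))
          ≡⟨ cong₂ (λ u v → c (transpose x o (transpose u v (transpose x z p))))
                   (transpose-atʳ x z) (transpose-fixed (∈∉⇒≢ x∈X o∉X ∘ sym) (z≢o ∘ sym)) ⟩
        c (transpose x o (transpose x o (transpose x z p)))      ≡⟨ cong c (transpose-involutive x o _) ⟩
        c (transpose x z p)                                      ≡⟨ cong c (transpose-comm x z p) ⟩
        c (transpose z x p)                                      ∎
        where open ≡-Reasoning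

      by-cases : Dec (o ∈ X′) → Coupling X′ Y′ (A + c x) (B + c y)
      by-cases (no o∉X′) = coupled (Perm.transpose x o ∘ₚ ρ₁)
        (relabel-transpose ρ₁ ρ₁-relabels (mk⇔ (⊥-elim ∘ evicted) (⊥-elim ∘ o∉X′)))
        z o cost-o-out (inj₂ (z∈X′ , o∉X′)) slack (begin
        (A + c x) + c z ≤⟨ +-monoˡ-≤ (c z) bound ⟩
        (B + c o) + c z ≡⟨ xy∙z≈xz∙y B (c o) (c z) ⟩
        (B + c z) + c o ≡⟨ cong (λ q → (B + q) + c o) cz≡cy ⟩
        (B + c y) + c o ∎)
        where open ≤-Reasoning
      by-cases (yes o∈X′) = coupled (Perm.transpose z o ∘ₚ ρ₁)
        (relabel-transpose ρ₁ ρ₁-relabels (mk⇔ (λ _ → o∈X′) (λ _ → z∈X′)))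
        z x cost-o-in (inj₂ (z∈X′ , evicted)) slack (bound-evicted z (+-mono-≤ A≤B (≤-reflexive cz≡cy)))

    evict-defect-z : ∀ {o} → o ∉ X → (∀ p → c (ρ ⟨$⟩ʳ p) ≡ c (transpose z o p)) →
                     A ≤ B → A + c z ≤ B + c o → x ≢ z → Coupling X′ Y′ (A + c x) (B + c y)
    evict-defect-z {o} o∉X cost A≤B bound x≢z = by-cases (o ∈? X′)
      where
      open Defect o∉X cost
      x≢o = ∈∉⇒≢ x∈X o∉X
      cy≡co : c y ≡ c o
      cy≡co = trans (cong c (sym ρz≡y)) cost-at
      slack = defect-slack A≤B bound
      z∈X′ = stays z∈X (x≢z ∘ sym)

      cost-o-out : ∀ p → c (ρ ⟨$⟩ʳ transpose x z (transpose x o p)) ≡ c (transpose z x p)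
      cost-o-out p = begin
        c (ρ ⟨$⟩ʳ transpose x z (transpose x o p))              ≡⟨ cost _ ⟩
        c (transpose z o (transpose x z (transpose x o p)))
          ≡⟨ cong (λ q → c (transpose z o q)) (transpose-natural (transpose-injective x z) x o p) ⟩
        c (transpose z o (transpose (transpose x z x) (transpose x z o) (transpose x z p)))
          ≡⟨ cong₂ (λ u v → c (transpose z o (transpose u v (transpose x z p))))
                   (transpose-atˡ x z) (transpose-fixed (x≢o ∘ sym) (∈∉⇒≢ z∈X o∉X ∘ sym)) ⟩
        c (transpose z o (transpose z o (transpose x z p)))      ≡⟨ cong c (transpose-involutive z o _) ⟩
        c (transpose x z p)                                      ≡⟨ cong c (transpose-comm x z p) ⟩
        c (transpose z x p)                                      ∎
        where open ≡-Reasoning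

      cost-o-in : ∀ p → c (ρ ⟨$⟩ʳ transpose x z (transpose z o p)) ≡ c (transpose o x p)
      cost-o-in p = begin
        c (ρ ⟨$⟩ʳ transpose x z (transpose z o p))              ≡⟨ cost _ ⟩
        c (transpose z o (transpose x z (transpose z o p)))      ≡⟨ cong c (transpose-conj z o x z p) ⟩
        c (transpose (transpose z o x) (transpose z o z) p)
          ≡⟨ cong₂ (λ u v → c (transpose u v p)) (transpose-fixed x≢z x≢o) (transpose-atˡ z o) ⟩
        c (transpose x o p)                                      ≡⟨ cong c (transpose-comm x o p) ⟩
        c (transpose o x p)                                      ∎
        where open ≡-Reasoning

      by-cases : Dec (o ∈ X′) → Coupling X′ Y′ (A + c x) (B + c y)
      by-cases (no o∉X′) = coupled (Perm.transpose x o ∘ₚ ρ₁)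
        (relabel-transpose ρ₁ ρ₁-relabels (mk⇔ (⊥-elim ∘ evicted) (⊥-elim ∘ o∉X′)))
        z x cost-o-out (inj₂ (z∈X′ , evicted)) slack
        (bound-evicted z (subst (λ q → A + c z ≤ B + q) (sym cy≡co) bound))
      by-cases (yes o∈X′) = coupled (Perm.transpose z o ∘ₚ ρ₁)
        (relabel-transpose ρ₁ ρ₁-relabels (mk⇔ (λ _ → o∈X′) (λ _ → z∈X′)))
        o x cost-o-in (inj₂ (o∈X′ , evicted)) slack
        (bound-evicted o (+-mono-≤ A≤B (≤-reflexive (sym cy≡co))))

    evict : ∀ {a o} → (∀ p → c (ρ ⟨$⟩ʳ p) ≡ c (transpose a o p)) → a ≡ o ⊎ (a ∈ X × o ∉ X) →
            A ≤ B → A + c a ≤ B + c o → (∀ l → c y ≤ c (lookup Y l)) → Coupling X′ Y′ (A + c x) (B + c y)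
    evict {a} cost (inj₁ refl) A≤B _ _ = evict-exact (λ p → trans (cost p) (cong c (transpose-refl a p))) A≤B
    evict {a} cost (inj₂ (a∈X , o∉X)) A≤B bound y-min with x ≟ a | z ≟ a
    ... | no x≢a   | no z≢a   = evict-defect-neither a∈X o∉X cost A≤B bound y-min x≢a z≢a
    ... | yes refl | yes z≡x  = evict-defect-both o∉X cost A≤B bound z≡x
    ... | yes refl | no z≢x   = evict-defect-x o∉X cost A≤B bound z≢x
    ... | no x≢z   | yes refl = evict-defect-z o∉X cost A≤B bound x≢z

  coupling-step : ∀ {X Y A B} (κ : Coupling X Y A B) {r} → r ∉ X → ∀ i j →
                  (∀ l → c (lookup X i) ≤ c (lookup X l)) → (∀ l → c (lookup Y j) ≤ c (lookup Y l)) →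
                  Coupling (X [ i ]≔ r) (Y [ j ]≔ (Coupling.ρ κ ⟨$⟩ʳ r)) (A + c (lookup X i)) (B + c (lookup Y j))
  coupling-step κ r∉X i j x-min y-min =
    Eviction.evict ρ relabels X-distinct Y-distinct r∉X i j x-min cost defect slack defect-bound y-min
    where open Coupling κ

  module _ (G : Alg m k) (G-greedy : IsGreedy c G) where

    greedy-coupled : ∀ n {h h′ X Y A B} → Coupling X Y A B →
                     (λ (σ : Vec (Page m) n) → A + run c G h X (toList σ)) ≼ (λ σ → B + run c G h′ Y (toList σ))
    greedy-coupled zero κ = ≼-[] (+-monoˡ-≤ 0ℚ (Coupling.slack κ))
    greedy-coupled (suc n) {h} {h′} {X} {Y} {A} {B} κ = ≼-∷ ρ step
      where
      open Coupling κ
      step : ∀ r → (λ σ → A + run c G h X (r ∷ toList σ)) ≼ (λ σ → B + run c G h′ Y ((ρ ⟨$⟩ʳ r) ∷ toList σ))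
      step r with r ∈? X | (ρ ⟨$⟩ʳ r) ∈? Y
      ... | yes _   | yes _    = greedy-coupled n κ
      ... | yes r∈X | no ρr∉Y  = contradiction (Equivalence.to (relabels r) r∈X) ρr∉Y
      ... | no r∉X  | yes ρr∈Y = contradiction (Equivalence.from (relabels r) ρr∈Y) r∉X
      ... | no r∉X  | no _     =
        ≼-mono (λ _ → ≤-reflexive (sym (+-assoc A (c (lookup X i)) _))) (λ _ → ≤-reflexive (+-assoc B (c (lookup Y j)) _))
          (greedy-coupled n (coupling-step κ r∉X i j (G-greedy h X r) (G-greedy h′ Y (ρ ⟨$⟩ʳ r))))
        where
        i = G h X r
        j = G h′ Y (ρ ⟨$⟩ʳ r)

    greedy-≼ : ∀ n {h h′} (B : Alg m k) t {C} → Distinct C →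
               (λ (σ : Vec (Page m) n) → t + run c G h C (toList σ)) ≼ (λ σ → t + run c B h′ C (toList σ))
    greedy-≼ zero B t _ = ≼-[] ≤-refl
    greedy-≼ (suc n) {h} {h′} B t {C} C-distinct = ≼-∷ Perm.id step
      where
      step : ∀ r → (λ σ → t + run c G h C (r ∷ toList σ)) ≼ (λ σ → t + run c B h′ C (r ∷ toList σ))
      step r with r ∈? C
      ... | yes _  = greedy-≼ n B t C-distinct
      ... | no r∉C =
        ≼-mono (λ _ → ≤-reflexive (sym (+-assoc t (c (lookup C i)) _))) (λ _ → ≤-reflexive (+-assoc t (c (lookup C j)) _))
          (≼-trans (greedy-coupled n {r ∷ h} {r ∷ h} κ) (greedy-≼ n B (t + c (lookup C j)) ([]≔-distinct C-distinct r∉C)))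
        where
        i = G h C r
        j = B h′ C r
        κ : Coupling (C [ i ]≔ r) (C [ j ]≔ r) (t + c (lookup C i)) (t + c (lookup C j))
        κ = Eviction.evict-exact {A = t} {B = t} Perm.id (λ _ → mk⇔ id id) C-distinct C-distinct r∉C i j
              (G-greedy h C r) (λ _ → refl) ≤-refl

theorem3 : {m k : ℕ} (c : Fin m → ℚ) → ((p : Fin m) → 0ℚ < c p) →
    (C₀ : Cache m k) → Distinct C₀ →
    (G : Alg m k) → IsGreedy c G →
    (B : Alg m k) → (n : ℕ) →
    Σ (Vec (Fin m) n ⤖ Vec (Fin m) n) (λ π →
      (σ : Vec (Fin m) n) →
        costOf c G C₀ (toList σ) ≤ costOf c B C₀ (toList (Bijection.to π σ)))
theorem3 c _ C₀ C₀-distinct G G-greedy B n = ↔⇒⤖ bijection , dominated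
  where
  open _≼_ (≼-mono (λ σ → ≤-reflexive (sym (+-identityˡ (costOf c G C₀ (toList σ)))))
                   (λ σ → ≤-reflexive (+-identityˡ (costOf c B C₀ (toList σ))))
                   (greedy-≼ c G G-greedy n B 0ℚ C₀-distinct))
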